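{- Fix an integer $r\ge 1$ and let $G_r(t,u,v,z)=\sum_{w} t^{\mathrm{length}(w)}u^{\mathrm{asc}(w)}v^{\mathrm{last}(w)}z^{\mathrm{zeros}(w)}$, the sum ranging over all ascent sequences $w=(x_1,\dots,x_n)$ with $x_1=\dots=x_r=0$ and $x_{r+1}=1$. Then $$(v-1-tv(1-u))\,G_r(t,u,v,z)=(v-1)t^{r+1}uvz^r+t\big((v-1)z-v\big)G_r(t,u,1,z)+tuv^2\,G_r(t,uv,1,z).$$
   Context: A sequence $(x_1,\dots,x_n)$ of nonnegative integers is an ascent sequence of length $n$ if $x_1=0$ and $x_i\in\{0,1,\dots,1+\mathrm{asc}(x_1,\dots,x_{i-1})\}$ for all $2\le i\le n$, where $\mathrm{asc}(y_1,\dots,y_k)=|\{1\le j<k: y_j<y_{j+1}\}|$ is the number of ascents. For an ascent sequence $w=(x_1,\dots,x_n)$: $\mathrm{length}(w)=n$, $\mathrm{asc}(w)$ is its number of ascents, $\mathrm{last}(w)=x_n$, and $\mathrm{zeros}(w)$ is the number of entries equal to $0$. $G_r$ is a formal power series in $t$ whose coefficients are polynomials in $u,v,z$. -}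

module Defs where

open import Level using (Level)
open import Data.Bool using (Bool; true; false; _∧_; if_then_else_)
open import Data.Nat using () renaming (_+_ to _+ℕ_)
open import Data.Nat using (ℕ; zero; suc; _<ᵇ_; _≡ᵇ_; _≤ᵇ_)
open import Data.List using (List; []; _∷_; _++_; [_]; map; concatMap; filter; foldr; length)
open import Data.Bool.Properties using (T?)
open import Algebra.Bundles using (CommutativeRing)

asc : List ℕ → ℕ
asc []           = 0
asc (x ∷ [])     = 0
asc (x ∷ y ∷ ys) = (if x <ᵇ y then 1 else 0) +ℕ asc (y ∷ ys)

-- last entry (only used on nonempty sequences; 0 for the empty one)
lastEntry : List ℕ → ℕ
lastEntry []           = 0
lastEntry (x ∷ [])     = x
lastEntry (x ∷ y ∷ ys) = lastEntry (y ∷ ys)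

zeros : List ℕ → ℕ
zeros []       = 0
zeros (x ∷ xs) = (if x ≡ᵇ 0 then 1 else 0) +ℕ zeros xs

-- Ascent sequences: x₁ = 0 and x_i ≤ 1 + asc(x₁,…,x_{i-1}) for i ≥ 2.

ascentFrom : List ℕ → List ℕ → Bool
ascentFrom prefix []         = true
ascentFrom []     (x ∷ rest) = (x ≡ᵇ 0) ∧ ascentFrom [ x ] rest
ascentFrom prefix@(_ ∷ _) (x ∷ rest) =
  (x ≤ᵇ suc (asc prefix)) ∧ ascentFrom (prefix ++ [ x ]) rest

isAscentSeq : List ℕ → Bool
isAscentSeq w = ascentFrom [] w

startsWith0ʳ1 : ℕ → List ℕ → Bool
startsWith0ʳ1 _       []       = false
startsWith0ʳ1 zero    (x ∷ xs) = x ≡ᵇ 1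
startsWith0ʳ1 (suc r) (x ∷ xs) = (x ≡ᵇ 0) ∧ startsWith0ʳ1 r xs

upto : ℕ → List ℕ
upto zero    = [ 0 ]
upto (suc b) = upto b ++ [ suc b ]

seqs : ℕ → ℕ → List (List ℕ)
seqs b zero    = [] ∷ []
seqs b (suc n) = concatMap (λ x → map (x ∷_) (seqs b n)) (upto b)

-- All ascent sequences of length n with x₁=…=x_r=0, x_{r+1}=1.
-- (Every entry of an ascent sequence of length n is ≤ n-1 ≤ n,
--  so candidates with entries in {0,…,n} cover all of them.)
relevant : ℕ → ℕ → List (List ℕ)
relevant r n = filter (λ w → T? (isAscentSeq w ∧ startsWith0ʳ1 r w)) (seqs n n)

module _ {c ℓ : Level} (R : CommutativeRing c ℓ) where
  open CommutativeRing R

  pow : Carrier → ℕ → Carrier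
  pow a zero    = 1#
  pow a (suc k) = a * pow a k

  weight : Carrier → Carrier → Carrier → List ℕ → Carrier
  weight u v z w = pow u (asc w) * pow v (lastEntry w) * pow z (zeros w)

  -- coefficient of t^n in G_r(t,u,v,z)
  Gcoeff : ℕ → Carrier → Carrier → Carrier → ℕ → Carrier
  Gcoeff r u v z n = foldr (λ w acc → weight u v z w + acc) 0# (relevant r n)

  -- coefficient of t^n in t·F, given the coefficient sequence of F
  tShift : (ℕ → Carrier) → ℕ → Carrier
  tShift f zero    = 0#
  tShift f (suc n) = f n

  -- coefficient of t^n in the monomial a·t^k
  monoT : ℕ → Carrier → ℕ → Carrier
  monoT k a n = if n ≡ᵇ k then a else 0#

module Submission where

-- Every relevant sequence of length m + 1 ≥ r + 2 is w x with w relevant of length m and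
-- 0 ≤ x ≤ 1 + asc w. Writing a = asc w, l = last w and k = zeros w, the weight of w x is
-- u^a z^k times z if x = 0, times v^x if 1 ≤ x ≤ l and times u v^x if x > l. Multiplying the
-- sum of these geometric progressions by v − 1 gives
--   (v − 1) Σₓ wt(w x) − v (1 − u) wt(w) = ((v − 1) z − v) u^a z^k + u v² (uv)^a z^k,
-- and summing over w is the coefficient of t^(m+1) in the functional equation. The term
-- t^(r+1) comes from the single relevant sequence 0^r 1; there are none that are shorter.

open import Defs
open import Level using (Level)
open import Data.Nat using (ℕ; zero; suc; _≤_)
open import Algebra.Bundles using (CommutativeRing)

-- Tactic.RingSolver does not recognise the operations of a ring that is a module parameter,
-- so Algebra.Solver.Ring is instantiated with integer coefficients via the map ℤ → R.
module ℤ-Solver {c ℓ : Level} (R : CommutativeRing c ℓ) where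
  open import Algebra.Solver.Ring.AlmostCommutativeRing using (fromCommutativeRing; _-Raw-AlmostCommutative⟶_)
  open import Data.Maybe using (Maybe; just; nothing)
  open import Data.Nat as ℕ using (zero; suc)
  import Data.Nat.Properties as ℕ
  open import Data.Integer as ℤ using (ℤ; +_; -[1+_]; +-*-rawRing)
  import Data.Integer.Properties as ℤ
  open import Data.Sign as Sign using (Sign)
  open import Relation.Binary.PropositionalEquality as ≡ using (_≡_)
  open import Relation.Nullary using (yes; no)

  open CommutativeRing R
  open import Algebra.Properties.Ring ring using (-1*x≈-x)
  open import Algebra.Properties.CommutativeSemigroup *-commutativeSemigroup using (interchange)
  open import Algebra.Properties.AbelianGroup +-abelianGroup using (⁻¹-∙-comm; ⁻¹-involutive; ε⁻¹≈ε)
  open import Algebra.Properties.Semiring.Mult.TCOptimised semiring using (_×_; 1+×; ×-homo-+; ×1-homo-*)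
  open import Relation.Binary.Reasoning.Setoid setoid

  ⟦_⟧ℤ : ℤ → Carrier
  ⟦ + n ⟧ℤ     = n × 1#
  ⟦ -[1+ n ] ⟧ℤ = - (suc n × 1#)

  private
    [x+y]-[x+z]≈y-z : ∀ x y z → (x + y) - (x + z) ≈ y - z
    [x+y]-[x+z]≈y-z x y z = begin
      (x + y) + - (x + z)     ≈⟨ +-congˡ (sym (⁻¹-∙-comm x z)) ⟩
      (x + y) + (- x + - z)   ≈⟨ +-congʳ (+-comm x y) ⟩
      (y + x) + (- x + - z)   ≈⟨ +-assoc y x _ ⟩
      y + (x + (- x + - z))   ≈⟨ +-congˡ (sym (+-assoc x (- x) (- z))) ⟩
      y + ((x - x) + - z)     ≈⟨ +-congˡ (+-congʳ (-‿inverseʳ x)) ⟩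
      y + (0# + - z)          ≈⟨ +-congˡ (+-identityˡ (- z)) ⟩
      y - z                   ∎

    ⊖-homo : ∀ m n → ⟦ m ℤ.⊖ n ⟧ℤ ≈ m × 1# - n × 1#
    ⊖-homo m       zero    = sym (trans (+-congˡ ε⁻¹≈ε) (+-identityʳ _))
    ⊖-homo zero    (suc n) = sym (+-identityˡ _)
    ⊖-homo (suc m) (suc n) = begin
      ⟦ suc m ℤ.⊖ suc n ⟧ℤ               ≡⟨ ≡.cong ⟦_⟧ℤ (ℤ.[1+m]⊖[1+n]≡m⊖n m n) ⟩
      ⟦ m ℤ.⊖ n ⟧ℤ                       ≈⟨ ⊖-homo m n ⟩
      m × 1# - n × 1#                    ≈⟨ [x+y]-[x+z]≈y-z 1# _ _ ⟨
      (1# + m × 1#) - (1# + n × 1#)      ≈⟨ +-cong (1+× m 1#) (-‿cong (1+× n 1#)) ⟨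
      suc m × 1# - suc n × 1#            ∎

    +-homo : ∀ i j → ⟦ i ℤ.+ j ⟧ℤ ≈ ⟦ i ⟧ℤ + ⟦ j ⟧ℤ
    +-homo (+ m)    (+ n)    = ×-homo-+ 1# m n
    +-homo (+ m)    -[1+ n ] = ⊖-homo m (suc n)
    +-homo -[1+ m ] (+ n)    = trans (⊖-homo n (suc m)) (+-comm _ _)
    +-homo -[1+ m ] -[1+ n ] = begin
      - (suc (suc (m ℕ.+ n)) × 1#)        ≡⟨ ≡.cong (λ k → - (suc k × 1#)) (ℕ.+-suc m n) ⟨
      - ((suc m ℕ.+ suc n) × 1#)          ≈⟨ -‿cong (×-homo-+ 1# (suc m) (suc n)) ⟩
      - (suc m × 1# + suc n × 1#)         ≈⟨ ⁻¹-∙-comm _ _ ⟨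
      - (suc m × 1#) + - (suc n × 1#)     ∎

    ⟦_⟧ₛ : Sign → Carrier
    ⟦ Sign.+ ⟧ₛ = 1#
    ⟦ Sign.- ⟧ₛ = - 1#

    ◃-homo : ∀ s n → ⟦ s ℤ.◃ n ⟧ℤ ≈ ⟦ s ⟧ₛ * (n × 1#)
    ◃-homo s      zero    = sym (zeroʳ _)
    ◃-homo Sign.+ (suc n) = sym (*-identityˡ _)
    ◃-homo Sign.- (suc n) = sym (-1*x≈-x _)

    sign-abs : ∀ i → ⟦ i ⟧ℤ ≈ ⟦ ℤ.sign i ⟧ₛ * (ℤ.∣ i ∣ × 1#)
    sign-abs (+ n)    = sym (*-identityˡ _)
    sign-abs -[1+ n ] = sym (-1*x≈-x _)

    sign-*-homo : ∀ s t → ⟦ s Sign.* t ⟧ₛ ≈ ⟦ s ⟧ₛ * ⟦ t ⟧ₛ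
    sign-*-homo Sign.+ t      = sym (*-identityˡ _)
    sign-*-homo Sign.- Sign.+ = sym (*-identityʳ _)
    sign-*-homo Sign.- Sign.- = sym (trans (-1*x≈-x _) (⁻¹-involutive _))

    *-homo : ∀ i j → ⟦ i ℤ.* j ⟧ℤ ≈ ⟦ i ⟧ℤ * ⟦ j ⟧ℤ
    *-homo i j = begin
      ⟦ i ℤ.* j ⟧ℤ                                ≈⟨ ◃-homo (s Sign.* t) (m ℕ.* n) ⟩
      ⟦ s Sign.* t ⟧ₛ * ((m ℕ.* n) × 1#)          ≈⟨ *-cong (sign-*-homo s t) (×1-homo-* m n) ⟩
      (⟦ s ⟧ₛ * ⟦ t ⟧ₛ) * ((m × 1#) * (n × 1#))   ≈⟨ interchange _ _ _ _ ⟩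
      (⟦ s ⟧ₛ * (m × 1#)) * (⟦ t ⟧ₛ * (n × 1#))   ≈⟨ *-cong (sign-abs i) (sign-abs j) ⟨
      ⟦ i ⟧ℤ * ⟦ j ⟧ℤ                             ∎
      where
      s = ℤ.sign i; t = ℤ.sign j; m = ℤ.∣ i ∣; n = ℤ.∣ j ∣

    -‿homo : ∀ i → ⟦ ℤ.- i ⟧ℤ ≈ - ⟦ i ⟧ℤ
    -‿homo (+ zero)  = sym ε⁻¹≈ε
    -‿homo (+ suc n) = refl
    -‿homo -[1+ n ]  = sym (⁻¹-involutive _)

    ℤ-homo : +-*-rawRing -Raw-AlmostCommutative⟶ fromCommutativeRing R
    ℤ-homo = record { ⟦_⟧ = ⟦_⟧ℤ ; +-homo = +-homo ; *-homo = *-homo ; -‿homo = -‿homo ; 0-homo = refl ; 1-homo = refl }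

    ℤ-equal? : ∀ i j → Maybe (⟦ i ⟧ℤ ≈ ⟦ j ⟧ℤ)
    ℤ-equal? i j with i ℤ.≟ j
    ... | yes ≡.refl = just refl
    ... | no _       = nothing

  open import Algebra.Solver.Ring +-*-rawRing (fromCommutativeRing R) ℤ-homo ℤ-equal? public

module AscentSequences where
  open import Data.Bool using (Bool; true; false; _∧_; if_then_else_; T)
  open import Data.Bool.Properties using (∧-assoc; ∧-identityʳ; ∧-zeroʳ; ∧-conicalˡ; ∧-conicalʳ; ∧-commutativeMonoid; T-≡)
  open import Data.List using (List; []; _∷_; _++_; [_]; _∷ʳ_; length; replicate)
  open import Data.List.Properties using (++-assoc; ++-identityʳ; length-++)
  open import Data.List.Relation.Unary.All using (All; []; _∷_)
  open import Data.Nat using (ℕ; zero; suc; _+_; _≤_; _<_; z≤n; s≤s; _<ᵇ_; _≡ᵇ_; _≤ᵇ_)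
  open import Data.Nat.Properties using (+-identityʳ; +-assoc; m≤m+n; m≤n⇒m≤1+n; ≤-reflexive; ≤-trans; ≡ᵇ⇒≡; ≤ᵇ⇒≤)
  open import Function.Bundles using (Equivalence)
  open import Algebra.Bundles using (CommutativeMonoid)
  open import Relation.Binary.PropositionalEquality hiding ([_])
  open ≡-Reasoning

  canExtend : List ℕ → ℕ → Bool
  canExtend []        x = x ≡ᵇ 0
  canExtend p@(_ ∷ _) x = x ≤ᵇ suc (asc p)

  ascentFrom-∷ : ∀ p x xs → ascentFrom p (x ∷ xs) ≡ canExtend p x ∧ ascentFrom (p ∷ʳ x) xs
  ascentFrom-∷ []      x xs = refl
  ascentFrom-∷ (_ ∷ _) x xs = refl

  ascentFrom-∷ʳ : ∀ p xs x → ascentFrom p (xs ∷ʳ x) ≡ ascentFrom p xs ∧ canExtend (p ++ xs) x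
  ascentFrom-∷ʳ p [] x = begin
    ascentFrom p [ x ]       ≡⟨ ascentFrom-∷ p x [] ⟩
    canExtend p x ∧ true     ≡⟨ ∧-identityʳ _ ⟩
    canExtend p x            ≡⟨ cong (λ q → canExtend q x) (++-identityʳ p) ⟨
    canExtend (p ++ []) x    ∎
  ascentFrom-∷ʳ p (y ∷ ys) x = begin
    ascentFrom p (y ∷ ys ∷ʳ x)
      ≡⟨ ascentFrom-∷ p y (ys ∷ʳ x) ⟩
    canExtend p y ∧ ascentFrom (p ∷ʳ y) (ys ∷ʳ x)
      ≡⟨ cong (canExtend p y ∧_) (ascentFrom-∷ʳ (p ∷ʳ y) ys x) ⟩
    canExtend p y ∧ (ascentFrom (p ∷ʳ y) ys ∧ canExtend ((p ∷ʳ y) ++ ys) x)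
      ≡⟨ ∧-assoc (canExtend p y) _ _ ⟨
    (canExtend p y ∧ ascentFrom (p ∷ʳ y) ys) ∧ canExtend ((p ∷ʳ y) ++ ys) x
      ≡⟨ cong₂ (λ b q → b ∧ canExtend q x) (sym (ascentFrom-∷ p y ys)) (++-assoc p [ y ] ys) ⟩
    ascentFrom p (y ∷ ys) ∧ canExtend (p ++ y ∷ ys) x
      ∎

  isAscentSeq-∷ʳ : ∀ w x → isAscentSeq (w ∷ʳ x) ≡ isAscentSeq w ∧ canExtend w x
  isAscentSeq-∷ʳ = ascentFrom-∷ʳ []

  startsWith0ʳ1-∷ʳ : ∀ r w x → r < length w → startsWith0ʳ1 r (w ∷ʳ x) ≡ startsWith0ʳ1 r w
  startsWith0ʳ1-∷ʳ zero    (y ∷ ys) x _         = refl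
  startsWith0ʳ1-∷ʳ (suc r) (y ∷ ys) x (s≤s r<n) = cong ((y ≡ᵇ 0) ∧_) (startsWith0ʳ1-∷ʳ r ys x r<n)

  startsWith0ʳ1-short : ∀ r w → length w ≤ r → startsWith0ʳ1 r w ≡ false
  startsWith0ʳ1-short r       []       _         = refl
  startsWith0ʳ1-short (suc r) (y ∷ ys) (s≤s n≤r) = trans (cong ((y ≡ᵇ 0) ∧_) (startsWith0ʳ1-short r ys n≤r)) (∧-zeroʳ _)

  isRelevant : ℕ → List ℕ → Bool
  isRelevant r w = isAscentSeq w ∧ startsWith0ʳ1 r w

  isRelevant-∷ʳ : ∀ r w x → r < length w → isRelevant r (w ∷ʳ x) ≡ isRelevant r w ∧ canExtend w x
  isRelevant-∷ʳ r w x r<n = trans (cong₂ _∧_ (isAscentSeq-∷ʳ w x) (startsWith0ʳ1-∷ʳ r w x r<n))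
                                  (xy∙z≈xz∙y (isAscentSeq w) _ _)
    where open import Algebra.Properties.CommutativeSemigroup (CommutativeMonoid.commutativeSemigroup ∧-commutativeMonoid) using (xy∙z≈xz∙y)

  isRelevant-short : ∀ r w → length w ≤ r → isRelevant r w ≡ false
  isRelevant-short r w n≤r = trans (cong (isAscentSeq w ∧_) (startsWith0ʳ1-short r w n≤r)) (∧-zeroʳ _)

  asc-∷ʳ : ∀ y ys x → asc (y ∷ ys ∷ʳ x) ≡ asc (y ∷ ys) + (if lastEntry (y ∷ ys) <ᵇ x then 1 else 0)
  asc-∷ʳ y []       x = +-identityʳ _
  asc-∷ʳ y (y′ ∷ ys) x = trans (cong (b +_) (asc-∷ʳ y′ ys x)) (sym (+-assoc b _ _))
    where b = if y <ᵇ y′ then 1 else 0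

  lastEntry-∷ʳ : ∀ w x → lastEntry (w ∷ʳ x) ≡ x
  lastEntry-∷ʳ []            x = refl
  lastEntry-∷ʳ (y ∷ [])      x = refl
  lastEntry-∷ʳ (y ∷ y′ ∷ ys) x = lastEntry-∷ʳ (y′ ∷ ys) x

  zeros-∷ʳ : ∀ w x → zeros (w ∷ʳ x) ≡ zeros w + (if x ≡ᵇ 0 then 1 else 0)
  zeros-∷ʳ []       x = +-identityʳ _
  zeros-∷ʳ (y ∷ ys) x = trans (cong (b +_) (zeros-∷ʳ ys x)) (sym (+-assoc b _ _))
    where b = if y ≡ᵇ 0 then 1 else 0

  asc≤length : ∀ y ys → asc (y ∷ ys) ≤ length ys
  asc≤length y []        = z≤n
  asc≤length y (y′ ∷ ys) with y <ᵇ y′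
  ... | true  = s≤s (asc≤length y′ ys)
  ... | false = m≤n⇒m≤1+n (asc≤length y′ ys)

  asc≤asc-∷ʳ : ∀ p x → asc p ≤ asc (p ∷ʳ x)
  asc≤asc-∷ʳ []       x = z≤n
  asc≤asc-∷ʳ (y ∷ ys) x = subst (asc (y ∷ ys) ≤_) (sym (asc-∷ʳ y ys x)) (m≤m+n _ _)

  private
    toT : ∀ {b} → b ≡ true → T b
    toT = Equivalence.from T-≡

  canExtend⇒≤length : ∀ p x → canExtend p x ≡ true → x ≤ length p
  canExtend⇒≤length []       x e = ≤-reflexive (≡ᵇ⇒≡ x 0 (toT e))
  canExtend⇒≤length (y ∷ ys) x e = ≤-trans (≤ᵇ⇒≤ x _ (toT e)) (s≤s (asc≤length y ys))

  canExtend⇒≤1+asc : ∀ p x → canExtend p x ≡ true → x ≤ suc (asc (p ∷ʳ x))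
  canExtend⇒≤1+asc []       x e = subst (_≤ 1) (sym (≡ᵇ⇒≡ x 0 (toT e))) z≤n
  canExtend⇒≤1+asc (y ∷ ys) x e = ≤-trans (≤ᵇ⇒≤ x _ (toT e)) (s≤s (asc≤asc-∷ʳ (y ∷ ys) x))

  ascentFrom⇒entries≤ : ∀ p xs → ascentFrom p xs ≡ true → All (_≤ length p + length xs) xs
  ascentFrom⇒entries≤ p []       _ = []
  ascentFrom⇒entries≤ p (x ∷ xs) e
    = ≤-trans (canExtend⇒≤length p x (∧-conicalˡ _ _ e′)) (m≤m+n _ _)
    ∷ subst (λ n → All (_≤ n) xs) length-eq (ascentFrom⇒entries≤ (p ∷ʳ x) xs (∧-conicalʳ _ _ e′))
    where
    e′ = trans (sym (ascentFrom-∷ p x xs)) e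
    length-eq : length (p ∷ʳ x) + length xs ≡ length p + suc (length xs)
    length-eq = trans (cong (_+ length xs) (length-++ p)) (+-assoc (length p) 1 _)

  isAscentSeq⇒entries≤length : ∀ w → isAscentSeq w ≡ true → All (_≤ length w) w
  isAscentSeq⇒entries≤length = ascentFrom⇒entries≤ []

  ascentFrom⇒lastEntry≤1+asc : ∀ p y ys → ascentFrom p (y ∷ ys) ≡ true →
                               lastEntry (p ++ y ∷ ys) ≤ suc (asc (p ++ y ∷ ys))
  ascentFrom⇒lastEntry≤1+asc p y [] e =
    subst (_≤ suc (asc (p ∷ʳ y))) (sym (lastEntry-∷ʳ p y))
          (canExtend⇒≤1+asc p y (∧-conicalˡ _ _ (trans (sym (ascentFrom-∷ p y [])) e)))
  ascentFrom⇒lastEntry≤1+asc p y (y′ ∷ ys) e =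
    subst (λ q → lastEntry q ≤ suc (asc q)) (++-assoc p [ y ] (y′ ∷ ys))
          (ascentFrom⇒lastEntry≤1+asc (p ∷ʳ y) y′ ys (∧-conicalʳ _ _ (trans (sym (ascentFrom-∷ p y (y′ ∷ ys))) e)))

  isAscentSeq⇒lastEntry≤1+asc : ∀ y ys → isAscentSeq (y ∷ ys) ≡ true → lastEntry (y ∷ ys) ≤ suc (asc (y ∷ ys))
  isAscentSeq⇒lastEntry≤1+asc = ascentFrom⇒lastEntry≤1+asc []

  private
    ascentFrom-0ʳ : ∀ p k → ascentFrom p (replicate k 0) ≡ true
    ascentFrom-0ʳ p       zero    = refl
    ascentFrom-0ʳ []      (suc k) = ascentFrom-0ʳ [ 0 ] k
    ascentFrom-0ʳ (_ ∷ _) (suc k) = ascentFrom-0ʳ _ k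

    asc-0ʳ : ∀ k → asc (replicate k 0) ≡ 0
    asc-0ʳ zero          = refl
    asc-0ʳ (suc zero)    = refl
    asc-0ʳ (suc (suc k)) = asc-0ʳ (suc k)

    lastEntry-0ʳ : ∀ k → lastEntry (replicate k 0) ≡ 0
    lastEntry-0ʳ zero          = refl
    lastEntry-0ʳ (suc zero)    = refl
    lastEntry-0ʳ (suc (suc k)) = lastEntry-0ʳ (suc k)

    zeros-0ʳ : ∀ k → zeros (replicate k 0) ≡ k
    zeros-0ʳ zero    = refl
    zeros-0ʳ (suc k) = cong suc (zeros-0ʳ k)

  isAscentSeq-0ʳ1 : ∀ r → isAscentSeq (replicate (suc r) 0 ∷ʳ 1) ≡ true
  isAscentSeq-0ʳ1 r = trans (isAscentSeq-∷ʳ (replicate (suc r) 0) 1) (cong (_∧ true) (ascentFrom-0ʳ [] (suc r)))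

  asc-0ʳ1 : ∀ r → asc (replicate (suc r) 0 ∷ʳ 1) ≡ 1
  asc-0ʳ1 r = trans (asc-∷ʳ 0 (replicate r 0) 1)
                    (cong₂ (λ a l → a + (if l <ᵇ 1 then 1 else 0)) (asc-0ʳ (suc r)) (lastEntry-0ʳ (suc r)))

  zeros-0ʳ1 : ∀ r → zeros (replicate r 0 ∷ʳ 1) ≡ r
  zeros-0ʳ1 r = trans (zeros-∷ʳ (replicate r 0) 1) (trans (+-identityʳ _) (zeros-0ʳ r))

module FiniteSums {c ℓ : Level} (R : CommutativeRing c ℓ) where
  open import Data.Bool using (Bool; true; false; _∧_; if_then_else_)
  open import Data.Bool.Properties using (T?)
  open import Data.List using (List; []; _∷_; _++_; [_]; _∷ʳ_; length; map; concatMap; filter; foldr; replicate)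
  open import Data.List.Relation.Unary.All using (All; _∷_)
  open import Data.Nat as ℕ using (ℕ; zero; suc; _≤_; _<_; s≤s; _≡ᵇ_; _≤ᵇ_)
  import Data.Nat.Properties as ℕ
  open import Relation.Binary.PropositionalEquality as ≡ using (_≡_)
  open import Relation.Nullary using (¬_)
  open import Relation.Nullary.Decidable using (dec-true; dec-false)

  open CommutativeRing R hiding (zero)
  open import Relation.Binary.Reasoning.Setoid setoid

  ∑ : {A : Set} → List A → (A → Carrier) → Carrier
  ∑ xs f = foldr (λ x acc → f x + acc) 0# xs

  when : Bool → Carrier → Carrier
  when b a = if b then a else 0#

  module _ {A : Set} where

    ∑-cong : ∀ (xs : List A) {f g} → (∀ x → f x ≈ g x) → ∑ xs f ≈ ∑ xs g
    ∑-cong []       f≈g = refl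
    ∑-cong (x ∷ xs) f≈g = +-cong (f≈g x) (∑-cong xs f≈g)

    ∑-zero : ∀ (xs : List A) {f} → (∀ x → f x ≈ 0#) → ∑ xs f ≈ 0#
    ∑-zero []       f≈0 = refl
    ∑-zero (x ∷ xs) f≈0 = trans (+-cong (f≈0 x) (∑-zero xs f≈0)) (+-identityˡ 0#)

    ∑-++ : ∀ (xs ys : List A) f → ∑ (xs ++ ys) f ≈ ∑ xs f + ∑ ys f
    ∑-++ []       ys f = sym (+-identityˡ _)
    ∑-++ (x ∷ xs) ys f = trans (+-congˡ (∑-++ xs ys f)) (sym (+-assoc _ _ _))

    ∑-map : ∀ {B : Set} (h : B → A) (xs : List B) f → ∑ (map h xs) f ≡ ∑ xs (λ x → f (h x))
    ∑-map h []       f = ≡.refl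
    ∑-map h (x ∷ xs) f = ≡.cong (f (h x) +_) (∑-map h xs f)

    ∑-concatMap : ∀ {B : Set} (F : B → List A) (xs : List B) f → ∑ (concatMap F xs) f ≈ ∑ xs (λ x → ∑ (F x) f)
    ∑-concatMap F []       f = refl
    ∑-concatMap F (x ∷ xs) f = trans (∑-++ (F x) (concatMap F xs) f) (+-congˡ (∑-concatMap F xs f))

    ∑-*ˡ : ∀ (xs : List A) a f → ∑ xs (λ x → a * f x) ≈ a * ∑ xs f
    ∑-*ˡ []       a f = sym (zeroʳ a)
    ∑-*ˡ (x ∷ xs) a f = trans (+-congˡ (∑-*ˡ xs a f)) (sym (distribˡ a _ _))

    ∑-when : ∀ (xs : List A) b f → ∑ xs (λ x → when b (f x)) ≈ when b (∑ xs f)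
    ∑-when xs true  f = refl
    ∑-when xs false f = ∑-zero xs (λ _ → refl)

    ∑-filter : ∀ (P : A → Bool) xs f → ∑ (filter (λ x → T? (P x)) xs) f ≈ ∑ xs (λ x → when (P x) (f x))
    ∑-filter P []       f = refl
    ∑-filter P (x ∷ xs) f with P x
    ... | true  = +-congˡ (∑-filter P xs f)
    ... | false = trans (∑-filter P xs f) (sym (+-identityˡ _))

    ∑-+ : ∀ (xs : List A) f g → ∑ xs (λ x → f x + g x) ≈ ∑ xs f + ∑ xs g
    ∑-+ []       f g = sym (+-identityˡ 0#)
    ∑-+ (x ∷ xs) f g = begin
      (f x + g x) + ∑ xs (λ x → f x + g x) ≈⟨ +-congˡ (∑-+ xs f g) ⟩
      (f x + g x) + (∑ xs f + ∑ xs g)      ≈⟨ +-assoc (f x) (g x) _ ⟩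
      f x + (g x + (∑ xs f + ∑ xs g))      ≈⟨ +-congˡ (x∙yz≈y∙xz (g x) _ _) ⟩
      f x + (∑ xs f + (g x + ∑ xs g))      ≈⟨ +-assoc (f x) _ _ ⟨
      (f x + ∑ xs f) + (g x + ∑ xs g)      ∎
      where open import Algebra.Properties.CommutativeSemigroup +-commutativeSemigroup using (x∙yz≈y∙xz)

    ∑-neg : ∀ (xs : List A) f → ∑ xs (λ x → - f x) ≈ - ∑ xs f
    ∑-neg []       f = sym ε⁻¹≈ε
      where open import Algebra.Properties.AbelianGroup +-abelianGroup using (ε⁻¹≈ε)
    ∑-neg (x ∷ xs) f = trans (+-congˡ (∑-neg xs f)) (⁻¹-∙-comm (f x) _)
      where open import Algebra.Properties.AbelianGroup +-abelianGroup using (⁻¹-∙-comm)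

  ∑-upto-suc : ∀ b (h : ℕ → Carrier) → ∑ (upto (suc b)) h ≈ ∑ (upto b) h + h (suc b)
  ∑-upto-suc b h = trans (∑-++ (upto b) [ suc b ] h) (+-congˡ (+-identityʳ _))

  ∑-upto-suc-head : ∀ b (h : ℕ → Carrier) → ∑ (upto (suc b)) h ≈ h 0 + ∑ (upto b) (λ x → h (suc x))
  ∑-upto-suc-head zero    h = refl
  ∑-upto-suc-head (suc b) h = begin
    ∑ (upto (suc (suc b))) h                            ≈⟨ ∑-upto-suc (suc b) h ⟩
    ∑ (upto (suc b)) h + h (suc (suc b))                ≈⟨ +-congʳ (∑-upto-suc-head b h) ⟩
    (h 0 + ∑ (upto b) (λ x → h (suc x))) + h (suc (suc b)) ≈⟨ +-assoc (h 0) _ _ ⟩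
    h 0 + (∑ (upto b) (λ x → h (suc x)) + h (suc (suc b))) ≈⟨ +-congˡ (∑-upto-suc b _) ⟨
    h 0 + ∑ (upto (suc b)) (λ x → h (suc x))            ∎

  ∑-upto-when-≡0 : ∀ b (h : ℕ → Carrier) → ∑ (upto b) (λ x → when (x ≡ᵇ 0) (h x)) ≈ h 0
  ∑-upto-when-≡0 zero    h = +-identityʳ _
  ∑-upto-when-≡0 (suc b) h =
    trans (∑-upto-suc b (λ x → when (x ≡ᵇ 0) (h x))) (trans (+-identityʳ _) (∑-upto-when-≡0 b h))

  ∑-upto-when-≡1 : ∀ b (h : ℕ → Carrier) → ∑ (upto (suc b)) (λ x → when (x ≡ᵇ 1) (h x)) ≈ h 1
  ∑-upto-when-≡1 b h = begin
    ∑ (upto (suc b)) (λ x → when (x ≡ᵇ 1) (h x))     ≈⟨ ∑-upto-suc-head b (λ x → when (x ≡ᵇ 1) (h x)) ⟩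
    0# + ∑ (upto b) (λ x → when (x ≡ᵇ 0) (h (suc x))) ≈⟨ +-identityˡ _ ⟩
    ∑ (upto b) (λ x → when (x ≡ᵇ 0) (h (suc x)))      ≈⟨ ∑-upto-when-≡0 b (λ x → h (suc x)) ⟩
    h 1                                               ∎

  ∑-upto-extend : ∀ b k (h : ℕ → Carrier) → (∀ x → b < x → h x ≈ 0#) → ∑ (upto (k ℕ.+ b)) h ≈ ∑ (upto b) h
  ∑-upto-extend b zero    h h≈0 = refl
  ∑-upto-extend b (suc k) h h≈0 = begin
    ∑ (upto (suc (k ℕ.+ b))) h           ≈⟨ ∑-upto-suc (k ℕ.+ b) h ⟩
    ∑ (upto (k ℕ.+ b)) h + h (suc (k ℕ.+ b)) ≈⟨ +-cong (∑-upto-extend b k h h≈0) (h≈0 _ (s≤s (ℕ.m≤n+m b k))) ⟩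
    ∑ (upto b) h + 0#                     ≈⟨ +-identityʳ _ ⟩
    ∑ (upto b) h                          ∎

  ∑-upto-when-≤ᵇ : ∀ {b b′} (h : ℕ → Carrier) → b ≤ b′ → ∑ (upto b′) (λ x → when (x ≤ᵇ b) (h x)) ≈ ∑ (upto b) h
  ∑-upto-when-≤ᵇ {b} {b′} h b≤b′ = begin
    ∑ (upto b′) (λ x → when (x ≤ᵇ b) (h x))                ≡⟨ ≡.cong (λ n → ∑ (upto n) _) (ℕ.m∸n+n≡m b≤b′) ⟨
    ∑ (upto ((b′ ℕ.∸ b) ℕ.+ b)) (λ x → when (x ≤ᵇ b) (h x)) ≈⟨ ∑-upto-extend b (b′ ℕ.∸ b) _ beyond ⟩
    ∑ (upto b) (λ x → when (x ≤ᵇ b) (h x))                  ≈⟨ below b ℕ.≤-refl ⟩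
    ∑ (upto b) h                                             ∎
    where
    beyond : ∀ x → b < x → when (x ≤ᵇ b) (h x) ≈ 0#
    beyond x b<x = reflexive (≡.cong (λ t → when t (h x)) (dec-false (x ℕ.≤? b) (ℕ.<⇒≱ b<x)))
    below : ∀ c → c ≤ b → ∑ (upto c) (λ x → when (x ≤ᵇ b) (h x)) ≈ ∑ (upto c) h
    below zero    _   = refl
    below (suc c) c<b = begin
      ∑ (upto (suc c)) (λ x → when (x ≤ᵇ b) (h x))        ≈⟨ ∑-upto-suc c _ ⟩
      ∑ (upto c) (λ x → when (x ≤ᵇ b) (h x)) + when (suc c ≤ᵇ b) (h (suc c))
        ≈⟨ +-cong (below c (ℕ.<⇒≤ c<b)) (reflexive (≡.cong (λ t → when t (h (suc c))) (dec-true (suc c ℕ.≤? b) c<b))) ⟩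
      ∑ (upto c) h + h (suc c)                             ≈⟨ ∑-upto-suc c h ⟨
      ∑ (upto (suc c)) h                                   ∎

  when-∧ : ∀ a b x → when (a ∧ b) x ≡ when a (when b x)
  when-∧ true  b x = ≡.refl
  when-∧ false b x = ≡.refl

  ∑-seqs-∷ : ∀ b n (g : List ℕ → Carrier) → ∑ (seqs b (suc n)) g ≈ ∑ (upto b) (λ x → ∑ (seqs b n) (λ w → g (x ∷ w)))
  ∑-seqs-∷ b n g = trans (∑-concatMap (λ x → map (x ∷_) (seqs b n)) (upto b) g)
                         (∑-cong (upto b) (λ x → reflexive (∑-map (x ∷_) (seqs b n) g)))

  ∑-seqs-cong : ∀ b n {f g : List ℕ → Carrier} → (∀ w → length w ≡ n → f w ≈ g w) → ∑ (seqs b n) f ≈ ∑ (seqs b n) g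
  ∑-seqs-cong b zero    f≈g = +-congʳ (f≈g [] ≡.refl)
  ∑-seqs-cong b (suc n) {f} {g} f≈g = begin
    ∑ (seqs b (suc n)) f                               ≈⟨ ∑-seqs-∷ b n f ⟩
    ∑ (upto b) (λ x → ∑ (seqs b n) (λ w → f (x ∷ w))) ≈⟨ ∑-cong (upto b) (λ x → ∑-seqs-cong b n (f≈g-∷ x)) ⟩
    ∑ (upto b) (λ x → ∑ (seqs b n) (λ w → g (x ∷ w))) ≈⟨ ∑-seqs-∷ b n g ⟨
    ∑ (seqs b (suc n)) g                               ∎
    where
    f≈g-∷ : ∀ x w → length w ≡ n → f (x ∷ w) ≈ g (x ∷ w)
    f≈g-∷ x w e = f≈g (x ∷ w) (≡.cong suc e)

  ∑-seqs-zero : ∀ b n {f : List ℕ → Carrier} → (∀ w → length w ≡ n → f w ≈ 0#) → ∑ (seqs b n) f ≈ 0#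
  ∑-seqs-zero b n f≈0 = trans (∑-seqs-cong b n f≈0) (∑-zero (seqs b n) (λ _ → refl))

  ∑-seqs-∷ʳ : ∀ b n (g : List ℕ → Carrier) → ∑ (seqs b (suc n)) g ≈ ∑ (seqs b n) (λ w → ∑ (upto b) (λ x → g (w ∷ʳ x)))
  ∑-seqs-∷ʳ b zero    g = trans (∑-seqs-∷ b zero g) (trans (∑-cong (upto b) (λ x → +-identityʳ _)) (sym (+-identityʳ _)))
  ∑-seqs-∷ʳ b (suc n) g = begin
    ∑ (seqs b (suc (suc n))) g
      ≈⟨ ∑-seqs-∷ b (suc n) g ⟩
    ∑ (upto b) (λ x → ∑ (seqs b (suc n)) (λ w → g (x ∷ w)))
      ≈⟨ ∑-cong (upto b) (λ x → ∑-seqs-∷ʳ b n (λ w → g (x ∷ w))) ⟩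
    ∑ (upto b) (λ x → ∑ (seqs b n) (λ w → ∑ (upto b) (λ y → g (x ∷ w ∷ʳ y))))
      ≈⟨ ∑-seqs-∷ b n _ ⟨
    ∑ (seqs b (suc n)) (λ w → ∑ (upto b) (λ x → g (w ∷ʳ x)))
      ∎

  ∑-seqs-bound : ∀ b k n (g : List ℕ → Carrier) → (∀ w → length w ≡ n → ¬ All (_≤ b) w → g w ≈ 0#) →
                 ∑ (seqs (k ℕ.+ b) n) g ≈ ∑ (seqs b n) g
  ∑-seqs-bound b k zero    g g≈0 = refl
  ∑-seqs-bound b k (suc n) g g≈0 = begin
    ∑ (seqs (k ℕ.+ b) (suc n)) g
      ≈⟨ ∑-seqs-∷ (k ℕ.+ b) n g ⟩
    ∑ (upto (k ℕ.+ b)) (λ x → ∑ (seqs (k ℕ.+ b) n) (λ w → g (x ∷ w)))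
      ≈⟨ ∑-cong (upto (k ℕ.+ b)) (λ x → ∑-seqs-bound b k n _ (tail-bound x)) ⟩
    ∑ (upto (k ℕ.+ b)) (λ x → ∑ (seqs b n) (λ w → g (x ∷ w)))
      ≈⟨ ∑-upto-extend b k _ head-bound ⟩
    ∑ (upto b) (λ x → ∑ (seqs b n) (λ w → g (x ∷ w)))
      ≈⟨ ∑-seqs-∷ b n g ⟨
    ∑ (seqs b (suc n)) g
      ∎
    where
    tail-bound : ∀ x w → length w ≡ n → ¬ All (_≤ b) w → g (x ∷ w) ≈ 0#
    tail-bound x w e ¬w≤b = g≈0 (x ∷ w) (≡.cong suc e) (λ { (_ ∷ w≤b) → ¬w≤b w≤b })
    head-bound : ∀ x → b < x → ∑ (seqs b n) (λ w → g (x ∷ w)) ≈ 0#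
    head-bound x b<x = ∑-seqs-zero b n (λ w e → g≈0 (x ∷ w) (≡.cong suc e) (λ { (x≤b ∷ _) → ℕ.<⇒≱ b<x x≤b }))

  ∑-seqs-0ʳ1 : ∀ b r (g : List ℕ → Carrier) →
               ∑ (seqs (suc b) (suc r)) (λ w → when (startsWith0ʳ1 r w) (g w)) ≈ g (replicate r 0 ∷ʳ 1)
  ∑-seqs-0ʳ1 b zero    g = trans (∑-seqs-∷ (suc b) zero _)
    (trans (∑-cong (upto (suc b)) (λ x → +-identityʳ _)) (∑-upto-when-≡1 b (λ x → g [ x ])))
  ∑-seqs-0ʳ1 b (suc r) g = begin
    ∑ (seqs (suc b) (suc (suc r))) (λ w → when (startsWith0ʳ1 (suc r) w) (g w))
      ≈⟨ ∑-seqs-∷ (suc b) (suc r) _ ⟩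
    ∑ (upto (suc b)) (λ x → ∑ (seqs (suc b) (suc r)) (λ w → when ((x ≡ᵇ 0) ∧ startsWith0ʳ1 r w) (g (x ∷ w))))
      ≈⟨ ∑-cong (upto (suc b)) (λ x → trans (∑-cong S (λ w → reflexive (when-∧ (x ≡ᵇ 0) _ _))) (∑-when S (x ≡ᵇ 0) _)) ⟩
    ∑ (upto (suc b)) (λ x → when (x ≡ᵇ 0) (∑ (seqs (suc b) (suc r)) (λ w → when (startsWith0ʳ1 r w) (g (x ∷ w)))))
      ≈⟨ ∑-upto-when-≡0 (suc b) _ ⟩
    ∑ (seqs (suc b) (suc r)) (λ w → when (startsWith0ʳ1 r w) (g (0 ∷ w)))
      ≈⟨ ∑-seqs-0ʳ1 b r (λ w → g (0 ∷ w)) ⟩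
    g (0 ∷ replicate r 0 ∷ʳ 1)
      ∎
    where S = seqs (suc b) (suc r)

  ∑-seqs-combination : ∀ b n α β γ δ (f g h k : List ℕ → Carrier) →
    (∀ w → length w ≡ n → α * f w - β * g w ≈ γ * h w + δ * k w) →
    α * ∑ (seqs b n) f - β * ∑ (seqs b n) g ≈ γ * ∑ (seqs b n) h + δ * ∑ (seqs b n) k
  ∑-seqs-combination b n α β γ δ f g h k pointwise = begin
    α * ∑ S f - β * ∑ S g                          ≈⟨ +-cong (∑-*ˡ S α f) (-‿cong (∑-*ˡ S β g)) ⟨
    ∑ S (λ w → α * f w) - ∑ S (λ w → β * g w)      ≈⟨ +-congˡ (∑-neg S (λ w → β * g w)) ⟨
    ∑ S (λ w → α * f w) + ∑ S (λ w → - (β * g w))  ≈⟨ ∑-+ S _ _ ⟨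
    ∑ S (λ w → α * f w - β * g w)                  ≈⟨ ∑-seqs-cong b n pointwise ⟩
    ∑ S (λ w → γ * h w + δ * k w)                  ≈⟨ ∑-+ S _ _ ⟩
    ∑ S (λ w → γ * h w) + ∑ S (λ w → δ * k w)      ≈⟨ +-cong (∑-*ˡ S γ h) (∑-*ˡ S δ k) ⟩
    γ * ∑ S h + δ * ∑ S k                          ∎
    where S = seqs b n

module Recurrence {c ℓ : Level} (R : CommutativeRing c ℓ) where
  open import Data.Bool using (true; false; if_then_else_)
  open import Data.Bool.Properties using (∧-comm; ∧-conicalˡ)
  open import Data.List using (List; []; _∷_; _∷ʳ_; length; replicate)
  open import Data.List.Relation.Unary.All using (All)
  open import Data.Nat as ℕ using (ℕ; zero; suc; _≤_; _<_; _≤′_; ≤′-refl; ≤′-step; s≤s; _<ᵇ_; _≡ᵇ_)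
  open import Relation.Binary.Definitions using (tri<; tri≈; tri>)
  import Data.Nat.Properties as ℕ
  open import Data.Integer using (+_)
  open import Data.Empty using (⊥-elim)
  open import Relation.Binary.PropositionalEquality as ≡ using (_≡_)
  open import Relation.Nullary using (¬_)
  open import Relation.Nullary.Decidable using (dec-true; dec-false)

  open CommutativeRing R hiding (zero)
  open import Algebra.Properties.CommutativeSemigroup *-commutativeSemigroup using (x∙yz≈y∙xz; interchange)
  open import Relation.Binary.Reasoning.Setoid setoid
  open AscentSequences
  open FiniteSums R
  open ℤ-Solver R using (solve; _:=_; _:+_; _:*_; _:-_; con)

  infixr 8 _^_
  _^_ : Carrier → ℕ → Carrier
  x ^ n = pow R x n

  ^-homo-* : ∀ x m n → x ^ (m ℕ.+ n) ≈ x ^ m * x ^ n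
  ^-homo-* x zero    n = sym (*-identityˡ _)
  ^-homo-* x (suc m) n = trans (*-congˡ (^-homo-* x m n)) (sym (*-assoc x _ _))

  ^-distrib-* : ∀ x y n → (x * y) ^ n ≈ x ^ n * y ^ n
  ^-distrib-* x y zero    = sym (*-identityˡ 1#)
  ^-distrib-* x y (suc n) = trans (*-congˡ (^-distrib-* x y n)) (interchange x y _ _)

  1#^n≈1# : ∀ n → 1# ^ n ≈ 1#
  1#^n≈1# zero    = refl
  1#^n≈1# (suc n) = trans (*-identityˡ _) (1#^n≈1# n)

  module _ (u v z : Carrier) where

    entryFactor : ℕ → ℕ → Carrier
    entryFactor l x = u ^ (if l <ᵇ x then 1 else 0) * v ^ x * z ^ (if x ≡ᵇ 0 then 1 else 0)

    weight-∷ʳ : ∀ y ys x → weight R u v z (y ∷ ys ∷ʳ x)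
                           ≈ (u ^ asc (y ∷ ys) * z ^ zeros (y ∷ ys)) * entryFactor (lastEntry (y ∷ ys)) x
    weight-∷ʳ y ys x = begin
      u ^ asc (w ∷ʳ x) * v ^ lastEntry (w ∷ʳ x) * z ^ zeros (w ∷ʳ x)
        ≡⟨ ≡.cong₂ (λ p q → u ^ p * v ^ lastEntry (w ∷ʳ x) * z ^ q) (asc-∷ʳ y ys x) (zeros-∷ʳ w x) ⟩
      u ^ (asc w ℕ.+ i) * v ^ lastEntry (w ∷ʳ x) * z ^ (zeros w ℕ.+ j)
        ≡⟨ ≡.cong (λ l → u ^ (asc w ℕ.+ i) * v ^ l * z ^ (zeros w ℕ.+ j)) (lastEntry-∷ʳ w x) ⟩
      u ^ (asc w ℕ.+ i) * v ^ x * z ^ (zeros w ℕ.+ j)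
        ≈⟨ *-cong (*-congʳ (^-homo-* u (asc w) i)) (^-homo-* z (zeros w) j) ⟩
      (u ^ asc w * u ^ i) * v ^ x * (z ^ zeros w * z ^ j)
        ≈⟨ solve 5 (λ A U V Z J → (A :* U) :* V :* (Z :* J) := (A :* Z) :* (U :* V :* J)) refl _ _ _ _ _ ⟩
      (u ^ asc w * z ^ zeros w) * entryFactor (lastEntry w) x
        ∎
      where
      w = y ∷ ys
      i = if lastEntry w <ᵇ x then 1 else 0
      j = if x ≡ᵇ 0 then 1 else 0

    entryFactor-zero : ∀ l → entryFactor l 0 ≈ z
    entryFactor-zero l = trans (*-cong (*-identityʳ 1#) (*-identityʳ z)) (*-identityˡ z)

    entryFactor-≤ : ∀ {l} x → suc x ≤ l → entryFactor l (suc x) ≈ v ^ suc x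
    entryFactor-≤ {l} x x<l = begin
      entryFactor l (suc x)  ≡⟨ ≡.cong (λ b → u ^ (if b then 1 else 0) * v ^ suc x * 1#) (dec-false (l ℕ.<? suc x) (ℕ.≤⇒≯ x<l)) ⟩
      1# * v ^ suc x * 1#    ≈⟨ trans (*-identityʳ _) (*-identityˡ _) ⟩
      v ^ suc x              ∎

    entryFactor-> : ∀ {l} x → l < suc x → entryFactor l (suc x) ≈ u * v ^ suc x
    entryFactor-> {l} x l<x = begin
      entryFactor l (suc x)     ≡⟨ ≡.cong (λ b → u ^ (if b then 1 else 0) * v ^ suc x * 1#) (dec-true (l ℕ.<? suc x) l<x) ⟩
      (u * 1#) * v ^ suc x * 1# ≈⟨ trans (*-identityʳ _) (*-congʳ (*-identityʳ u)) ⟩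
      u * v ^ suc x             ∎

    geometric-≤ : ∀ {l} K → K ≤ l → (v - 1#) * ∑ (upto K) (entryFactor l) ≈ (v - 1#) * z + (v ^ suc K - v)
    geometric-≤ {l} zero _ = begin
      (v - 1#) * (entryFactor l 0 + 0#)
        ≈⟨ *-congˡ (+-congʳ (entryFactor-zero l)) ⟩
      (v - 1#) * (z + 0#)
        ≈⟨ solve 2 (λ v z → (v :- con (+ 1)) :* (z :+ con (+ 0)) := (v :- con (+ 1)) :* z :+ (v :* con (+ 1) :- v)) refl v z ⟩
      (v - 1#) * z + (v * 1# - v)
        ∎
    geometric-≤ {l} (suc K) K<l = begin
      (v - 1#) * ∑ (upto (suc K)) (entryFactor l)
        ≈⟨ *-congˡ (∑-upto-suc K (entryFactor l)) ⟩
      (v - 1#) * (∑ (upto K) (entryFactor l) + entryFactor l (suc K))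
        ≈⟨ distribˡ _ _ _ ⟩
      (v - 1#) * ∑ (upto K) (entryFactor l) + (v - 1#) * entryFactor l (suc K)
        ≈⟨ +-cong (geometric-≤ K (ℕ.<⇒≤ K<l)) (*-congˡ (entryFactor-≤ K K<l)) ⟩
      (v - 1#) * z + (v * v ^ K - v) + (v - 1#) * (v * v ^ K)
        ≈⟨ solve 3 (λ v z V → (v :- con (+ 1)) :* z :+ (v :* V :- v) :+ (v :- con (+ 1)) :* (v :* V)
                              := (v :- con (+ 1)) :* z :+ (v :* (v :* V) :- v)) refl v z (v ^ K) ⟩
      (v - 1#) * z + (v * (v * v ^ K) - v)
        ∎

    geometric-≥ : ∀ {l K} → l ≤′ K → (v - 1#) * ∑ (upto K) (entryFactor l)
                  ≈ (v - 1#) * z + (v ^ suc l - v) + u * (v ^ suc K - v ^ suc l)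
    geometric-≥ {l} ≤′-refl = trans (geometric-≤ l ℕ.≤-refl)
      (solve 4 (λ v z u L → (v :- con (+ 1)) :* z :+ (v :* L :- v) := (v :- con (+ 1)) :* z :+ (v :* L :- v) :+ u :* (v :* L :- v :* L))
             refl v z u (v ^ l))
    geometric-≥ {l} (≤′-step {K} l≤′K) = begin
      (v - 1#) * ∑ (upto (suc K)) (entryFactor l)
        ≈⟨ *-congˡ (∑-upto-suc K (entryFactor l)) ⟩
      (v - 1#) * (∑ (upto K) (entryFactor l) + entryFactor l (suc K))
        ≈⟨ distribˡ _ _ _ ⟩
      (v - 1#) * ∑ (upto K) (entryFactor l) + (v - 1#) * entryFactor l (suc K)
        ≈⟨ +-cong (geometric-≥ l≤′K) (*-congˡ (entryFactor-> K (s≤s (ℕ.≤′⇒≤ l≤′K)))) ⟩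
      (v - 1#) * z + (v * v ^ l - v) + u * (v * v ^ K - v * v ^ l) + (v - 1#) * (u * (v * v ^ K))
        ≈⟨ solve 5 (λ v z u L V → (v :- con (+ 1)) :* z :+ (v :* L :- v) :+ u :* (v :* V :- v :* L) :+ (v :- con (+ 1)) :* (u :* (v :* V))
                                := (v :- con (+ 1)) :* z :+ (v :* L :- v) :+ u :* (v :* (v :* V) :- v :* L)) refl v z u (v ^ l) (v ^ K) ⟩
      (v - 1#) * z + (v * v ^ l - v) + u * (v * (v * v ^ K) - v * v ^ l)
        ∎

    ∑-extensions-identity : ∀ y ys → isAscentSeq (y ∷ ys) ≡ true →
      (v - 1#) * ∑ (upto (suc (asc (y ∷ ys)))) (λ x → weight R u v z (y ∷ ys ∷ʳ x)) - v * (1# - u) * weight R u v z (y ∷ ys)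
      ≈ ((v - 1#) * z - v) * weight R u 1# z (y ∷ ys) + u * v * v * weight R (u * v) 1# z (y ∷ ys)
    ∑-extensions-identity y ys ascent = begin
      (v - 1#) * ∑ (upto (suc a)) (λ x → weight R u v z (w ∷ʳ x)) - v * (1# - u) * (U * V * Z)
        ≈⟨ +-congʳ (*-congˡ (trans (∑-cong (upto (suc a)) (weight-∷ʳ y ys)) (∑-*ˡ (upto (suc a)) (U * Z) (entryFactor l)))) ⟩
      (v - 1#) * ((U * Z) * ∑ (upto (suc a)) (entryFactor l)) - v * (1# - u) * (U * V * Z)
        ≈⟨ +-congʳ (trans (x∙yz≈y∙xz (v - 1#) (U * Z) _) (*-congˡ (geometric-≥ (ℕ.≤⇒≤′ l≤1+a)))) ⟩
      (U * Z) * ((v - 1#) * z + (v * V - v) + u * (v * (v * W) - v * V)) - v * (1# - u) * (U * V * Z)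
        ≈⟨ solve 7 (λ v z u U Z V W →
             (U :* Z) :* ((v :- con (+ 1)) :* z :+ (v :* V :- v) :+ u :* (v :* (v :* W) :- v :* V)) :- v :* (con (+ 1) :- u) :* (U :* V :* Z)
             := ((v :- con (+ 1)) :* z :- v) :* (U :* con (+ 1) :* Z) :+ u :* v :* v :* (U :* W :* con (+ 1) :* Z)) refl v z u U Z V W ⟩
      ((v - 1#) * z - v) * (U * 1# * Z) + u * v * v * (U * W * 1# * Z)
        ≈⟨ +-cong (*-congˡ (*-congʳ (*-congˡ (1#^n≈1# l)))) (*-congˡ (*-congʳ (*-cong (^-distrib-* u v a) (1#^n≈1# l)))) ⟨
      ((v - 1#) * z - v) * weight R u 1# z w + u * v * v * weight R (u * v) 1# z w
        ∎
      where
      w = y ∷ ys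
      a = asc w
      l = lastEntry w
      U = u ^ a
      V = v ^ l
      W = v ^ a
      Z = z ^ zeros w
      l≤1+a = isAscentSeq⇒lastEntry≤1+asc y ys ascent

  Gcoeff-as-∑ : ∀ r u v z n → Gcoeff R r u v z n ≈ ∑ (seqs n n) (λ w → when (isRelevant r w) (weight R u v z w))
  Gcoeff-as-∑ r u v z n = ∑-filter (isRelevant r) (seqs n n) (weight R u v z)

  Gcoeff-short : ∀ r u v z n → n ≤ r → Gcoeff R r u v z n ≈ 0#
  Gcoeff-short r u v z n n≤r = trans (Gcoeff-as-∑ r u v z n) (∑-seqs-zero n n vanish)
    where
    vanish : ∀ w → length w ≡ n → when (isRelevant r w) (weight R u v z w) ≈ 0#
    vanish w ≡.refl = reflexive (≡.cong (λ b → when b (weight R u v z w)) (isRelevant-short r w n≤r))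

  Gcoeff-first : ∀ r u v z → Gcoeff R (suc r) u v z (suc (suc r)) ≈ u * v * z ^ suc r
  Gcoeff-first r u v z = begin
    Gcoeff R (suc r) u v z (suc (suc r))
      ≈⟨ Gcoeff-as-∑ (suc r) u v z (suc (suc r)) ⟩
    ∑ (seqs (suc (suc r)) (suc (suc r))) (λ w → when (isRelevant (suc r) w) (weight R u v z w))
      ≈⟨ ∑-cong (seqs (suc (suc r)) (suc (suc r))) (λ w → reflexive (starts-outside w)) ⟩
    ∑ (seqs (suc (suc r)) (suc (suc r))) (λ w → when (startsWith0ʳ1 (suc r) w) (when (isAscentSeq w) (weight R u v z w)))
      ≈⟨ ∑-seqs-0ʳ1 (suc r) (suc r) _ ⟩
    when (isAscentSeq w₀) (weight R u v z w₀)
      ≡⟨ ≡.cong (λ b → when b (weight R u v z w₀)) (isAscentSeq-0ʳ1 r) ⟩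
    u ^ asc w₀ * v ^ lastEntry w₀ * z ^ zeros w₀
      ≡⟨ ≡.cong₂ (λ a l → u ^ a * v ^ l * z ^ zeros w₀) (asc-0ʳ1 r) (lastEntry-∷ʳ (replicate (suc r) 0) 1) ⟩
    u ^ 1 * v ^ 1 * z ^ zeros w₀
      ≡⟨ ≡.cong (λ k → u ^ 1 * v ^ 1 * z ^ k) (zeros-0ʳ1 (suc r)) ⟩
    u ^ 1 * v ^ 1 * z ^ suc r
      ≈⟨ *-congʳ (*-cong (*-identityʳ u) (*-identityʳ v)) ⟩
    u * v * z ^ suc r
      ∎
    where
    w₀ = replicate (suc r) 0 ∷ʳ 1
    starts-outside : ∀ w → when (isRelevant (suc r) w) (weight R u v z w)
                           ≡ when (startsWith0ʳ1 (suc r) w) (when (isAscentSeq w) (weight R u v z w))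
    starts-outside w = ≡.trans (≡.cong (λ b → when b (weight R u v z w)) (∧-comm (isAscentSeq w) _))
                               (when-∧ (startsWith0ʳ1 (suc r) w) (isAscentSeq w) (weight R u v z w))

  Gcoeff-recurrence : ∀ r u v z m → suc r ≤ m →
    (v - 1#) * Gcoeff R r u v z (suc m) - v * (1# - u) * Gcoeff R r u v z m
    ≈ ((v - 1#) * z - v) * Gcoeff R r u 1# z m + u * v * v * Gcoeff R r (u * v) 1# z m
  Gcoeff-recurrence r u v z m r<m = begin
    (v - 1#) * Gcoeff R r u v z (suc m) - v * (1# - u) * Gcoeff R r u v z m
      ≈⟨ +-cong (*-congˡ Gcoeff-suc) (-‿cong (*-congˡ (Gcoeff-as-∑ r u v z m))) ⟩
    (v - 1#) * ∑ (seqs m m) (relevantly inner) - v * (1# - u) * ∑ (seqs m m) (relevantly (weight R u v z))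
      ≈⟨ ∑-seqs-combination m m _ _ _ _ _ _ _ _ pointwise ⟩
    ((v - 1#) * z - v) * ∑ (seqs m m) (relevantly (weight R u 1# z)) + u * v * v * ∑ (seqs m m) (relevantly (weight R (u * v) 1# z))
      ≈⟨ +-cong (*-congˡ (Gcoeff-as-∑ r u 1# z m)) (*-congˡ (Gcoeff-as-∑ r (u * v) 1# z m)) ⟨
    ((v - 1#) * z - v) * Gcoeff R r u 1# z m + u * v * v * Gcoeff R r (u * v) 1# z m
      ∎
    where
    relevantly : (List ℕ → Carrier) → List ℕ → Carrier
    relevantly f w = when (isRelevant r w) (f w)

    inner : List ℕ → Carrier
    inner w = ∑ (upto (suc m)) (λ x → when (canExtend w x) (weight R u v z (w ∷ʳ x)))

    appended : ∀ w → length w ≡ m →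
      ∑ (upto (suc m)) (λ x → relevantly (weight R u v z) (w ∷ʳ x)) ≈ relevantly inner w
    appended w ≡.refl = trans (∑-cong (upto (suc m)) (λ x → reflexive (split x))) (∑-when (upto (suc m)) (isRelevant r w) _)
      where
      split : ∀ x → relevantly (weight R u v z) (w ∷ʳ x) ≡ when (isRelevant r w) (when (canExtend w x) (weight R u v z (w ∷ʳ x)))
      split x = ≡.trans (≡.cong (λ b → when b (weight R u v z (w ∷ʳ x))) (isRelevant-∷ʳ r w x r<m))
                        (when-∧ (isRelevant r w) (canExtend w x) (weight R u v z (w ∷ʳ x)))

    bounded : ∀ w → length w ≡ m → ¬ All (_≤ m) w → relevantly inner w ≈ 0#
    bounded w len ¬w≤m with isRelevant r w in eq
    ... | false = refl
    ... | true  = ⊥-elim (¬w≤m (≡.subst (λ n → All (_≤ n) w) len (isAscentSeq⇒entries≤length w (∧-conicalˡ _ _ eq))))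

    Gcoeff-suc : Gcoeff R r u v z (suc m) ≈ ∑ (seqs m m) (relevantly inner)
    Gcoeff-suc = begin
      Gcoeff R r u v z (suc m)
        ≈⟨ Gcoeff-as-∑ r u v z (suc m) ⟩
      ∑ (seqs (suc m) (suc m)) (relevantly (weight R u v z))
        ≈⟨ ∑-seqs-∷ʳ (suc m) m _ ⟩
      ∑ (seqs (suc m) m) (λ w → ∑ (upto (suc m)) (λ x → relevantly (weight R u v z) (w ∷ʳ x)))
        ≈⟨ ∑-seqs-cong (suc m) m appended ⟩
      ∑ (seqs (suc m) m) (relevantly inner)
        ≈⟨ ∑-seqs-bound m 1 m _ bounded ⟩
      ∑ (seqs m m) (relevantly inner)
        ∎

    pointwise : ∀ w → length w ≡ m →
      (v - 1#) * relevantly inner w - v * (1# - u) * relevantly (weight R u v z) w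
      ≈ ((v - 1#) * z - v) * relevantly (weight R u 1# z) w + u * v * v * relevantly (weight R (u * v) 1# z) w
    pointwise w len with isRelevant r w in eq
    ... | false = solve 4 (λ a b c d → a :* con (+ 0) :- b :* con (+ 0) := c :* con (+ 0) :+ d :* con (+ 0)) refl _ _ _ _
    pointwise [] ≡.refl | true = ⊥-elim (ℕ.n≮0 r<m)
    pointwise (y ∷ ys) len | true = begin
      (v - 1#) * inner (y ∷ ys) - v * (1# - u) * weight R u v z (y ∷ ys)
        ≈⟨ +-congʳ (*-congˡ (∑-upto-when-≤ᵇ _ (s≤s a≤m))) ⟩
      (v - 1#) * ∑ (upto (suc (asc (y ∷ ys)))) (λ x → weight R u v z (y ∷ ys ∷ʳ x)) - v * (1# - u) * weight R u v z (y ∷ ys)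
        ≈⟨ ∑-extensions-identity u v z y ys (∧-conicalˡ _ _ eq) ⟩
      ((v - 1#) * z - v) * weight R u 1# z (y ∷ ys) + u * v * v * weight R (u * v) 1# z (y ∷ ys)
        ∎
      where
      a≤m : asc (y ∷ ys) ≤ m
      a≤m = ≡.subst (asc (y ∷ ys) ≤_) len (ℕ.m≤n⇒m≤1+n (asc≤length y ys))

  private
    trivial-identity : ∀ a b c d → a * 0# - b * 0# ≈ 0# + c * 0# + d * 0#
    trivial-identity = solve 4 (λ a b c d → a :* con (+ 0) :- b :* con (+ 0) := con (+ 0) :+ c :* con (+ 0) :+ d :* con (+ 0)) refl

  coefficient-identity-zero : ∀ r u v z →
    (v - 1#) * Gcoeff R r u v z 0 - v * (1# - u) * 0# ≈ 0# + ((v - 1#) * z - v) * 0# + u * v * v * 0#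
  coefficient-identity-zero r u v z =
    trans (+-congʳ (*-congˡ (Gcoeff-short r u v z 0 ℕ.z≤n))) (trivial-identity _ _ _ _)

  coefficient-identity-suc : ∀ r u v z m →
    (v - 1#) * Gcoeff R (suc r) u v z (suc m) - v * (1# - u) * Gcoeff R (suc r) u v z m
    ≈ (if m ≡ᵇ suc r then (v - 1#) * u * v * z ^ suc r else 0#)
      + ((v - 1#) * z - v) * Gcoeff R (suc r) u 1# z m + u * v * v * Gcoeff R (suc r) (u * v) 1# z m
  coefficient-identity-suc r u v z m with ℕ.<-cmp m (suc r)
  ... | tri< m<1+r m≢1+r _ rewrite dec-false (m ℕ.≟ suc r) m≢1+r = begin
    (v - 1#) * G u v z (suc m) - v * (1# - u) * G u v z m
      ≈⟨ +-cong (*-congˡ (Gcoeff-short _ u v z (suc m) m<1+r)) (-‿cong (*-congˡ (Gcoeff-short _ u v z m m≤r))) ⟩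
    (v - 1#) * 0# - v * (1# - u) * 0#
      ≈⟨ trivial-identity _ _ _ _ ⟩
    0# + ((v - 1#) * z - v) * 0# + u * v * v * 0#
      ≈⟨ +-cong (+-congˡ (*-congˡ (Gcoeff-short _ u 1# z m m≤r))) (*-congˡ (Gcoeff-short _ (u * v) 1# z m m≤r)) ⟨
    0# + ((v - 1#) * z - v) * G u 1# z m + u * v * v * G (u * v) 1# z m
      ∎
    where
    G = Gcoeff R (suc r)
    m≤r = ℕ.<⇒≤ m<1+r
  ... | tri≈ _ ≡.refl _ rewrite dec-true (r ℕ.≟ r) ≡.refl = begin
    (v - 1#) * G u v z (suc (suc r)) - v * (1# - u) * G u v z (suc r)
      ≈⟨ +-cong (*-congˡ (Gcoeff-first r u v z)) (-‿cong (*-congˡ (Gcoeff-short _ u v z (suc r) ℕ.≤-refl))) ⟩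
    (v - 1#) * (u * v * z ^ suc r) - v * (1# - u) * 0#
      ≈⟨ solve 6 (λ v u Z b c d → (v :- con (+ 1)) :* (u :* v :* Z) :- b :* con (+ 0)
                                  := (v :- con (+ 1)) :* u :* v :* Z :+ c :* con (+ 0) :+ d :* con (+ 0)) refl v u (z ^ suc r) _ _ _ ⟩
    (v - 1#) * u * v * z ^ suc r + ((v - 1#) * z - v) * 0# + u * v * v * 0#
      ≈⟨ +-cong (+-congˡ (*-congˡ (Gcoeff-short _ u 1# z (suc r) ℕ.≤-refl))) (*-congˡ (Gcoeff-short _ (u * v) 1# z (suc r) ℕ.≤-refl)) ⟨
    (v - 1#) * u * v * z ^ suc r + ((v - 1#) * z - v) * G u 1# z (suc r) + u * v * v * G (u * v) 1# z (suc r)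
      ∎
    where G = Gcoeff R (suc r)
  ... | tri> _ m≢1+r 1+r<m rewrite dec-false (m ℕ.≟ suc r) m≢1+r =
    trans (Gcoeff-recurrence (suc r) u v z m 1+r<m) (sym (+-congʳ (+-identityˡ _)))

lemma2 : {c ℓ : Level} (R : CommutativeRing c ℓ) (r : ℕ) → 1 ≤ r →
    (u v z : CommutativeRing.Carrier R) (n : ℕ) →
    let open CommutativeRing R
        G = Gcoeff R r
    in (v - 1#) * G u v z n - (v * (1# - u)) * tShift R (G u v z) n
       ≈ monoT R (suc r) ((v - 1#) * u * v * pow R z r) n
         + ((v - 1#) * z - v) * tShift R (G u 1# z) n
         + u * v * v * tShift R (G (u * v) 1# z) n
-- tShift and monoT compute on the constructor of n, so each clause is an instance of the above.
lemma2 R (suc r) _ u v z zero    = Recurrence.coefficient-identity-zero R (suc r) u v z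
lemma2 R (suc r) _ u v z (suc m) = Recurrence.coefficient-identity-suc R r u v z m
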